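{- Let $x,x',x''\in\mathbb{YF}$ with $x=x'x''$. Then $d(\varepsilon,x)=d(\varepsilon,x'')\,d\bigl(\varepsilon,x'1^{|x''|}\bigr)$.
   Context: Words are finite words over $\{1,2\}$; $\varepsilon$ is the empty word; $|x|$ is the digit sum; concatenation is $xy$ and $1^k$ is the word of $k$ letters $1$. $\mathbb{YF}$ is the set of all finite words. A word $y$ covers $x$ if $y$ is obtained from $x$ by replacing the leftmost $1$ of $x$ by $2$, or by inserting a $1$ somewhere to the left of the leftmost $1$ of $x$ (anywhere if $x$ has no $1$). $d(x,y)$ is the number of sequences $y=y_0,\dots,y_r=x$, $r=|y|-|x|\ge0$, with $y_j$ covering $y_{j+1}$ for all $j$. -}

module Defs where

open import Data.Nat using (ℕ; zero; suc; _+_; _∸_)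
open import Data.List using (List; []; _∷_; map; _++_; replicate)
open import Data.Nat.ListAction using (sum)
open import Data.Bool using (Bool; true; false)

data Letter : Set where
  ①' ②' : Letter

-- Finite words over {1,2} (the set YF); ε is []
Word : Set
Word = List Letter

val : Letter → ℕ
val ①' = 1
val ②' = 2

∣_∣ʷ : Word → ℕ
∣ [] ∣ʷ = 0
∣ a ∷ x ∣ʷ = val a + ∣ x ∣ʷ

ones : ℕ → Word
ones k = replicate k ①'

eqL : Letter → Letter → Bool
eqL ①' ①' = true
eqL ②' ②' = true
eqL _ _ = false

eqW : Word → Word → Bool
eqW [] [] = true
eqW (a ∷ x) (b ∷ y) with eqL a b
... | true = eqW x y
... | false = false
eqW _ _ = false

-- All words covering x (each listed once):
--  * replace the leftmost 1 of x by 2;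
--  * insert a 1 at any position to the left of the leftmost 1 of x
--    (anywhere if x has no 1).
-- Processing x = 2^m 1 z (or x = 2^m): insertion positions are 0..m,
-- the replacement gives 2^m 2 z.
upCovers : Word → List Word
upCovers [] = (①' ∷ []) ∷ []
upCovers (①' ∷ z) = (②' ∷ z) ∷ (①' ∷ ①' ∷ z) ∷ []
upCovers (②' ∷ z) = (①' ∷ ②' ∷ z) ∷ map (②' ∷_) (upCovers z)

-- number of chains x = y_r ⋖ y_{r-1} ⋖ … ⋖ y_0 = y of length n
chains : ℕ → Word → Word → ℕ
chains zero x y with eqW x y
... | true = 1
... | false = 0
chains (suc n) x y = sum (map (λ z → chains n z y) (upCovers x))

-- d(x,y): number of saturated chains from y down to x, r = |y| - |x|
-- (if |y| < |x| then r = 0 and x ≠ y, so d = 0 as required)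
d : Word → Word → ℕ
d x y = chains (∣ y ∣ʷ ∸ ∣ x ∣ʷ) x y

-- The number of saturated chains from ε up to y obeys d(ε,ε) = 1, d(ε,1z) = d(ε,z) and
-- d(ε,2z) = (|z| + 1) d(ε,z).  Each letter of x' thus contributes a factor depending only
-- on the weight of what follows it, and these weights agree in x'x'' and x'1^|x''|.
-- The recursion for d(ε,2z) comes from counting chains from the top: the elements covered
-- by 2z are 1z and the words 2w with w covered by z, and inductively each d(ε,2w) equals
-- |z| d(ε,w), whose sum over w is |z| d(ε,z).
module Submission where

open import Defs
open import Data.Nat using (ℕ; zero; suc; _+_; _*_; _<_; s≤s)
open import Data.Nat.Properties
  using (+-assoc; +-identityʳ; *-identityʳ; *-zeroʳ; *-distribˡ-+; suc-injective; ≤-refl; ≤-trans; ≤-reflexive;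
         +-commutativeSemigroup; *-commutativeSemigroup)
open import Data.Nat.ListAction using (sum)
open import Data.List using (List; []; _∷_; map; _++_)
open import Data.List.Properties using (map-cong; map-cong-local; map-∘)
open import Data.List.Relation.Unary.All as All using (All; []; _∷_)
open import Data.List.Relation.Unary.All.Properties using (map⁺)
open import Data.Bool using (Bool; true; false)
open import Algebra.Properties.CommutativeSemigroup +-commutativeSemigroup using (interchange)
open import Algebra.Properties.CommutativeSemigroup *-commutativeSemigroup using (x∙yz≈y∙xz)
open import Relation.Binary.PropositionalEquality

sum-map-0 : {A : Set} (xs : List A) → sum (map (λ _ → 0) xs) ≡ 0
sum-map-0 [] = refl
sum-map-0 (_ ∷ xs) = sum-map-0 xs

sum-map-+ : {A : Set} (f g : A → ℕ) (xs : List A) →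
  sum (map (λ a → f a + g a) xs) ≡ sum (map f xs) + sum (map g xs)
sum-map-+ f g [] = refl
sum-map-+ f g (a ∷ xs) =
  trans (cong (f a + g a +_) (sum-map-+ f g xs)) (interchange (f a) (g a) _ _)

sum-map-*ˡ : {A : Set} (k : ℕ) (f : A → ℕ) (xs : List A) →
  sum (map (λ a → k * f a) xs) ≡ k * sum (map f xs)
sum-map-*ˡ k f [] = sym (*-zeroʳ k)
sum-map-*ˡ k f (a ∷ xs) =
  trans (cong (k * f a +_) (sum-map-*ˡ k f xs)) (sym (*-distribˡ-+ k (f a) _))

sum-map-swap : {A B : Set} (f : A → B → ℕ) (as : List A) (bs : List B) →
  sum (map (λ a → sum (map (f a) bs)) as) ≡ sum (map (λ b → sum (map (λ a → f a b) as)) bs)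
sum-map-swap f [] bs = sym (sum-map-0 bs)
sum-map-swap f (a ∷ as) bs =
  trans (cong (sum (map (f a) bs) +_) (sum-map-swap f as bs))
        (sym (sum-map-+ (f a) (λ b → sum (map (λ a → f a b) as)) bs))

sum-map-∘ : {A B : Set} (f : B → ℕ) (g : A → B) (xs : List A) →
  sum (map f (map g xs)) ≡ sum (map (λ a → f (g a)) xs)
sum-map-∘ f g xs = cong sum (sym (map-∘ xs))

∣∣ʷ-++ : ∀ u v → ∣ u ++ v ∣ʷ ≡ ∣ u ∣ʷ + ∣ v ∣ʷ
∣∣ʷ-++ [] v = refl
∣∣ʷ-++ (a ∷ u) v = trans (cong (val a +_) (∣∣ʷ-++ u v)) (sym (+-assoc (val a) _ _))

∣ones∣ʷ : ∀ k → ∣ ones k ∣ʷ ≡ k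
∣ones∣ʷ zero = refl
∣ones∣ʷ (suc k) = cong suc (∣ones∣ʷ k)

∣∣ʷ-++-ones : ∀ u v → ∣ u ++ v ∣ʷ ≡ ∣ u ++ ones ∣ v ∣ʷ ∣ʷ
∣∣ʷ-++-ones u v = begin
  ∣ u ++ v ∣ʷ                  ≡⟨ ∣∣ʷ-++ u v ⟩
  ∣ u ∣ʷ + ∣ v ∣ʷ              ≡⟨ cong (∣ u ∣ʷ +_) (sym (∣ones∣ʷ ∣ v ∣ʷ)) ⟩
  ∣ u ∣ʷ + ∣ ones ∣ v ∣ʷ ∣ʷ    ≡⟨ sym (∣∣ʷ-++ u (ones ∣ v ∣ʷ)) ⟩
  ∣ u ++ ones ∣ v ∣ʷ ∣ʷ        ∎
  where open ≡-Reasoning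

lowerCovers : Word → List Word
lowerCovers [] = []
lowerCovers (①' ∷ z) = z ∷ []
lowerCovers (②' ∷ z) = (①' ∷ z) ∷ map (②' ∷_) (lowerCovers z)

lowerCovers-∣∣ʷ : ∀ y → All (λ w → suc ∣ w ∣ʷ ≡ ∣ y ∣ʷ) (lowerCovers y)
lowerCovers-∣∣ʷ [] = []
lowerCovers-∣∣ʷ (①' ∷ z) = refl ∷ []
lowerCovers-∣∣ʷ (②' ∷ z) =
  refl ∷ map⁺ (All.map (cong (λ t → suc (suc t))) (lowerCovers-∣∣ʷ z))

iverson : Bool → ℕ
iverson true = 1
iverson false = 0

chains-zero : ∀ x y → chains 0 x y ≡ iverson (eqW x y)
chains-zero x y with eqW x y
... | true = refl
... | false = refl

vanishes-on-②∷ : (f : Word → ℕ) → (∀ w → f (②' ∷ w) ≡ 0) → ∀ ws → sum (map f (map (②' ∷_) ws)) ≡ 0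
vanishes-on-②∷ f f≡0 ws = trans (sum-map-∘ f (②' ∷_) ws) (trans (cong sum (map-cong f≡0 ws)) (sum-map-0 ws))

-- Both sides count the covering steps x ⋖ y, once from below and once from above.
upCovers-lowerCovers-dual : ∀ x y →
  sum (map (λ z → iverson (eqW z y)) (upCovers x)) ≡ sum (map (λ w → iverson (eqW x w)) (lowerCovers y))
upCovers-lowerCovers-dual [] [] = refl
upCovers-lowerCovers-dual [] (①' ∷ z) = refl
upCovers-lowerCovers-dual [] (②' ∷ z) = sym (vanishes-on-②∷ _ (λ _ → refl) (lowerCovers z))
upCovers-lowerCovers-dual (①' ∷ u) [] = refl
upCovers-lowerCovers-dual (①' ∷ u) (①' ∷ z) = refl
upCovers-lowerCovers-dual (①' ∷ u) (②' ∷ z) =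
  cong (iverson (eqW u z) +_) (sym (vanishes-on-②∷ _ (λ _ → refl) (lowerCovers z)))
upCovers-lowerCovers-dual (②' ∷ u) [] = vanishes-on-②∷ _ (λ _ → refl) (upCovers u)
upCovers-lowerCovers-dual (②' ∷ u) (①' ∷ z) =
  cong (iverson (eqW (②' ∷ u) z) +_) (vanishes-on-②∷ _ (λ _ → refl) (upCovers u))
upCovers-lowerCovers-dual (②' ∷ u) (②' ∷ z) = begin
  sum (map (λ v → iverson (eqW v (②' ∷ z))) (map (②' ∷_) (upCovers u)))
    ≡⟨ sum-map-∘ _ (②' ∷_) (upCovers u) ⟩
  sum (map (λ v → iverson (eqW v z)) (upCovers u))
    ≡⟨ upCovers-lowerCovers-dual u z ⟩
  sum (map (λ w → iverson (eqW u w)) (lowerCovers z))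
    ≡⟨ sum-map-∘ _ (②' ∷_) (lowerCovers z) ⟨
  sum (map (λ w → iverson (eqW (②' ∷ u) w)) (map (②' ∷_) (lowerCovers z)))
    ∎
  where open ≡-Reasoning

chains-suc-lowerCovers : ∀ n x y → chains (suc n) x y ≡ sum (map (chains n x) (lowerCovers y))
chains-suc-lowerCovers zero x y = begin
  sum (map (λ z → chains 0 z y) (upCovers x))
    ≡⟨ cong sum (map-cong (λ z → chains-zero z y) (upCovers x)) ⟩
  sum (map (λ z → iverson (eqW z y)) (upCovers x))
    ≡⟨ upCovers-lowerCovers-dual x y ⟩
  sum (map (λ w → iverson (eqW x w)) (lowerCovers y))
    ≡⟨ cong sum (map-cong (chains-zero x) (lowerCovers y)) ⟨
  sum (map (chains 0 x) (lowerCovers y))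
    ∎
  where open ≡-Reasoning
chains-suc-lowerCovers (suc n) x y = begin
  sum (map (λ z → chains (suc n) z y) (upCovers x))
    ≡⟨ cong sum (map-cong (λ z → chains-suc-lowerCovers n z y) (upCovers x)) ⟩
  sum (map (λ z → sum (map (chains n z) (lowerCovers y))) (upCovers x))
    ≡⟨ sum-map-swap (λ z w → chains n z w) (upCovers x) (lowerCovers y) ⟩
  sum (map (chains (suc n) x) (lowerCovers y))
    ∎
  where open ≡-Reasoning

d₀ : Word → ℕ
d₀ = d []

-- The hypothesis excludes y = [], which covers nothing although d₀ [] = 1.
d₀-lowerCovers : ∀ {k} y → ∣ y ∣ʷ ≡ suc k → d₀ y ≡ sum (map d₀ (lowerCovers y))
d₀-lowerCovers {k} y ∣y∣≡1+k = begin
  chains ∣ y ∣ʷ [] y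
    ≡⟨ cong (λ m → chains m [] y) ∣y∣≡1+k ⟩
  chains (suc k) [] y
    ≡⟨ chains-suc-lowerCovers k [] y ⟩
  sum (map (chains k []) (lowerCovers y))
    ≡⟨ cong sum (map-cong-local (All.map (λ {w} → rank-is-k w) (lowerCovers-∣∣ʷ y))) ⟩
  sum (map d₀ (lowerCovers y))
    ∎
  where
  open ≡-Reasoning
  rank-is-k : ∀ w → suc ∣ w ∣ʷ ≡ ∣ y ∣ʷ → chains k [] w ≡ d₀ w
  rank-is-k w eq = cong (λ m → chains m [] w) (suc-injective (sym (trans eq ∣y∣≡1+k)))

d₀-①∷ : ∀ z → d₀ (①' ∷ z) ≡ d₀ z
d₀-①∷ z = trans (d₀-lowerCovers (①' ∷ z) refl) (+-identityʳ (d₀ z))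

∣∣ʷ*d₀-lowerCovers : ∀ z → ∣ z ∣ʷ * sum (map d₀ (lowerCovers z)) ≡ ∣ z ∣ʷ * d₀ z
∣∣ʷ*d₀-lowerCovers [] = refl
∣∣ʷ*d₀-lowerCovers (①' ∷ z) = cong (suc ∣ z ∣ʷ *_) (sym (d₀-lowerCovers (①' ∷ z) refl))
∣∣ʷ*d₀-lowerCovers (②' ∷ z) = cong (suc (suc ∣ z ∣ʷ) *_) (sym (d₀-lowerCovers (②' ∷ z) refl))

-- Induction on an upper bound n for the weight, as lowerCovers is not structural.
d₀-②∷-bounded : ∀ n z → ∣ z ∣ʷ < n → d₀ (②' ∷ z) ≡ suc ∣ z ∣ʷ * d₀ z
d₀-②∷-bounded (suc n) z (s≤s ∣z∣≤n) = begin
  d₀ (②' ∷ z)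
    ≡⟨ d₀-lowerCovers (②' ∷ z) refl ⟩
  d₀ (①' ∷ z) + sum (map d₀ (map (②' ∷_) (lowerCovers z)))
    ≡⟨ cong₂ _+_ (d₀-①∷ z) (sum-map-∘ d₀ (②' ∷_) (lowerCovers z)) ⟩
  d₀ z + sum (map (λ w → d₀ (②' ∷ w)) (lowerCovers z))
    ≡⟨ cong (d₀ z +_) (cong sum (map-cong-local (All.map (λ {w} → d₀-②∷-below w) (lowerCovers-∣∣ʷ z)))) ⟩
  d₀ z + sum (map (λ w → ∣ z ∣ʷ * d₀ w) (lowerCovers z))
    ≡⟨ cong (d₀ z +_) (trans (sum-map-*ˡ ∣ z ∣ʷ d₀ (lowerCovers z)) (∣∣ʷ*d₀-lowerCovers z)) ⟩
  d₀ z + ∣ z ∣ʷ * d₀ z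
    ∎
  where
  open ≡-Reasoning
  d₀-②∷-below : ∀ w → suc ∣ w ∣ʷ ≡ ∣ z ∣ʷ → d₀ (②' ∷ w) ≡ ∣ z ∣ʷ * d₀ w
  d₀-②∷-below w eq =
    trans (d₀-②∷-bounded n w (≤-trans (≤-reflexive eq) ∣z∣≤n)) (cong (_* d₀ w) eq)

d₀-②∷ : ∀ z → d₀ (②' ∷ z) ≡ suc ∣ z ∣ʷ * d₀ z
d₀-②∷ z = d₀-②∷-bounded (suc ∣ z ∣ʷ) z ≤-refl

d₀-ones : ∀ k → d₀ (ones k) ≡ 1
d₀-ones zero = refl
d₀-ones (suc k) = trans (d₀-①∷ (ones k)) (d₀-ones k)

d₀-++ : ∀ u v → d₀ (u ++ v) ≡ d₀ v * d₀ (u ++ ones ∣ v ∣ʷ)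
d₀-++ [] v = sym (trans (cong (d₀ v *_) (d₀-ones ∣ v ∣ʷ)) (*-identityʳ (d₀ v)))
d₀-++ (①' ∷ u) v = begin
  d₀ (①' ∷ u ++ v)                   ≡⟨ d₀-①∷ (u ++ v) ⟩
  d₀ (u ++ v)                        ≡⟨ d₀-++ u v ⟩
  d₀ v * d₀ (u ++ ones ∣ v ∣ʷ)       ≡⟨ cong (d₀ v *_) (d₀-①∷ (u ++ ones ∣ v ∣ʷ)) ⟨
  d₀ v * d₀ (①' ∷ u ++ ones ∣ v ∣ʷ)  ∎
  where open ≡-Reasoning
d₀-++ (②' ∷ u) v = begin
  d₀ (②' ∷ u ++ v)                       ≡⟨ d₀-②∷ (u ++ v) ⟩
  suc ∣ u ++ v ∣ʷ * d₀ (u ++ v)          ≡⟨ cong₂ (λ s t → suc s * t) (∣∣ʷ-++-ones u v) (d₀-++ u v) ⟩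
  suc ∣ u′ ∣ʷ * (d₀ v * d₀ u′)           ≡⟨ x∙yz≈y∙xz (suc ∣ u′ ∣ʷ) (d₀ v) (d₀ u′) ⟩
  d₀ v * (suc ∣ u′ ∣ʷ * d₀ u′)           ≡⟨ cong (d₀ v *_) (d₀-②∷ u′) ⟨
  d₀ v * d₀ (②' ∷ u′)                    ∎
  where
  open ≡-Reasoning
  u′ : Word
  u′ = u ++ ones ∣ v ∣ʷ

mainTheorem13 : (x x′ x″ : Word) → x ≡ x′ ++ x″ →
    d [] x ≡ d [] x″ * d [] (x′ ++ ones ∣ x″ ∣ʷ)
mainTheorem13 x x′ x″ refl = d₀-++ x′ x″
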